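{- Let $\mathcal{V},\mathcal{W}$ be vector bundles on the Fargues–Fontaine curve $X$, let $C$ be a positive integer, and let $\tilde{\mathcal{V}},\tilde{\mathcal{W}}$ be vector bundles on $X$ whose HN polygons are obtained by vertically stretching $\mathrm{HN}(\mathcal{V})$ and $\mathrm{HN}(\mathcal{W})$ by the factor $C$ (i.e. applying $(x,y)\mapsto(x,Cy)$). Then $$\deg\big((\tilde{\mathcal{V}}^\vee\otimes\tilde{\mathcal{W}})^{\geq0}\big)=C\cdot\deg\big((\mathcal{V}^\vee\otimes\mathcal{W})^{\geq0}\big).$$
   Context: $X$ is the Fargues–Fontaine curve attached to a finite extension $E/\mathbb{Q}_p$ and an algebraically closed perfectoid field $F$ of characteristic $p$. Every vector bundle $\mathcal{V}$ has a unique HN decomposition $\mathcal{V}\simeq\bigoplus_i\mathcal{O}(\lambda_i)^{\oplus m_i}$ ($\lambda_1>\lambda_2>\cdots$, $\mathcal{O}(\lambda)$ the stable bundle of slope $\lambda$ with rank the denominator of $\lambda$) and is determined up to isomorphism by its HN polygon $\mathrm{HN}(\mathcal{V})$, the concave polygon from the origin to $(\mathrm{rk}\mathcal{V},\deg\mathcal{V})$ with successive edges of slopes $\lambda_i$ and horizontal lengths $m_i\,\mathrm{rk}\,\mathcal{O}(\lambda_i)$; every such concave polygon with integer vertices arises. $(\cdot)^{\geq0}$ denotes the sum of HN summands of slope $\geq0$. -}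

module Defs where

open import Data.Nat as ℕ using (ℕ; suc)
open import Data.Nat.DivMod using (_/_)
open import Data.Integer as ℤ using (ℤ)
open import Data.Rational as ℚ using (ℚ; ↥_; ↧ₙ_; 0ℚ; -_)
open import Data.Rational.Properties using (_≤?_; _≟_)
open import Data.List using (List; []; _∷_; _++_; concatMap; map)
open import Data.Product using (_×_; _,_)
open import Relation.Nullary using (yes; no)
open import Relation.Binary.PropositionalEquality using (_≡_)

-- By the classification (see context), a bundle is (up to isomorphism) a
-- direct sum  ⨁ O(λ)^{⊕ m};  we represent it by the list of pairs (λ , m).
-- O(λ) is the stable bundle of slope λ, of rank the denominator of λ and
-- degree the numerator of λ (λ in lowest terms).
Summand : Set
Summand = ℚ × ℕ

Bundle : Set
Bundle = List Summand

rkO : ℚ → ℕ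
rkO a = ↧ₙ a

degO : ℚ → ℤ
degO a = ↥ a

deg : Bundle → ℤ
deg [] = ℤ.+ 0
deg ((a , m) ∷ V) = (ℤ.+ m) ℤ.* degO a ℤ.+ deg V

_⊕_ : Bundle → Bundle → Bundle
_⊕_ = _++_

dual : Bundle → Bundle
dual = map (λ { (a , m) → (- a , m) })

-- tensor product:  O(λ) ⊗ O(μ) is semistable of slope λ+μ and rank
-- rk O(λ) · rk O(μ), hence ≅ O(λ+μ)^{⊕ rkλ·rkμ / rk O(λ+μ)}.
tensorSummand : Summand → Summand → Summand
tensorSummand (a , m) (μ , n) =
  (a ℚ.+ μ , (m ℕ.* n ℕ.* (rkO a ℕ.* rkO μ)) / rkO (a ℚ.+ μ))

_⊗_ : Bundle → Bundle → Bundle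
V ⊗ W = concatMap (λ s → map (tensorSummand s) W) V

nonneg : Bundle → Bundle
nonneg [] = []
nonneg ((a , m) ∷ V) with 0ℚ ≤? a
... | yes _ = (a , m) ∷ nonneg V
... | no  _ = nonneg V

-- HN polygon, encoded by its edge data: for each slope λ, the horizontal
-- length of the edge of slope λ (0 if there is none).  A concave polygon
-- from the origin is determined by this finitely supported function
-- (edges are arranged in order of decreasing slope).
hnLength : Bundle → ℚ → ℕ
hnLength [] μ = 0
hnLength ((a , m) ∷ V) μ with a ≟ μ
... | yes _ = m ℕ.* rkO a ℕ.+ hnLength V μ
... | no  _ = hnLength V μ

-- HN(V') is HN(V) stretched vertically by C, i.e. the image of HN(V) under
-- (x , y) ↦ (x , C y): the edge of slope λ and length ℓ becomes the edge of
-- slope Cλ and length ℓ.  (Since C > 0, λ ↦ Cλ is a bijection of ℚ.)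
IsVertStretch : ℕ → Bundle → Bundle → Set
IsVertStretch C V V' = ∀ (a : ℚ) → hnLength V' ((ℤ.+ C) ℚ./ 1 ℚ.* a) ≡ hnLength V a

-- HN(𝒱) is a measure on slopes: the edge of slope λ carries its horizontal length.
-- Since O(λ)^∨ ⊗ O(μ) is semistable of slope μ − λ and rank rk O(λ) · rk O(μ),
-- deg((𝒱^∨ ⊗ 𝒲)^{≥0}) is the integral of (μ − λ)⁺ against the product of the two
-- measures.  Stretching by C pushes both measures forward along λ ↦ Cλ, and
-- (Cμ − Cλ)⁺ = C (μ − λ)⁺ for C > 0.
module Submission where

open import Defs
open import Data.Nat using (ℕ; NonZero)
open import Data.Integer using (_*_; +_)
open import Relation.Binary.PropositionalEquality using (_≡_)

open import Data.Nat as ℕ using (suc)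
import Data.Nat.Properties as ℕ
import Data.Nat.Solver as ℕ-Solver
open import Data.Nat.Divisibility using (_∣_; divides; ∣n⇒∣m*n)
open import Data.Nat.DivMod using (_/_; m/n*n≡m)
open import Data.Integer as ℤ using (ℤ)
import Data.Integer.Properties as ℤ
open import Data.Integer.GCD using (gcd)
open import Data.Rational as ℚ using (ℚ; mkℚ; ↥_; ↧_; ↧ₙ_; 0ℚ; 1ℚ; -_; 1/_; _⊔_; Positive)
import Data.Rational.Properties as ℚ
open import Data.Rational.Literals using (fromℤ)
import Data.Rational.Solver as ℚ-Solver
open import Data.Rational.Unnormalised as ℚᵘ using (mkℚᵘ; *≡*)
import Data.Rational.Unnormalised.Properties as ℚᵘ
open import Data.List using (List; []; _∷_; _++_; map; deduplicate)
open import Data.List.Membership.Propositional using (_∈_; _∉_)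
open import Data.List.Membership.Propositional.Properties using (∈-map⁺; ∈-++⁺ˡ; ∈-++⁺ʳ; ∈-deduplicate⁺)
open import Data.List.Relation.Binary.Subset.Propositional using (_⊆_)
import Data.List.Relation.Unary.All as All
open import Data.List.Relation.Unary.Any using (here; there)
open import Data.List.Relation.Unary.Unique.Propositional using (Unique; []; _∷_)
import Data.List.Relation.Unary.Unique.Propositional.Properties as Unique
import Data.List.Relation.Unary.Unique.DecPropositional.Properties as DecUnique
open import Data.Product using (_,_; proj₁)
open import Function using (_∘_)
open import Relation.Nullary using (yes; no; ¬_; contradiction)
open import Relation.Binary.PropositionalEquality using (refl; sym; trans; cong; cong₂; subst; module ≡-Reasoning)

open ≡-Reasoning

fromℤ-+ : ∀ x y → fromℤ (x ℤ.+ y) ≡ fromℤ x ℚ.+ fromℤ y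
fromℤ-+ x y = ℚ.toℚᵘ-injective (ℚᵘ.≃-trans step (ℚᵘ.≃-sym (ℚ.toℚᵘ-homo-+ (fromℤ x) (fromℤ y))))
  where
  step : mkℚᵘ (x ℤ.+ y) 0 ℚᵘ.≃ mkℚᵘ x 0 ℚᵘ.+ mkℚᵘ y 0
  step = *≡* (cong (ℤ._* + 1) (cong₂ ℤ._+_ (sym (ℤ.*-identityʳ x)) (sym (ℤ.*-identityʳ y))))

fromℤ-* : ∀ x y → fromℤ (x ℤ.* y) ≡ fromℤ x ℚ.* fromℤ y
fromℤ-* x y = ℚ.toℚᵘ-injective (ℚᵘ.≃-sym (ℚ.toℚᵘ-homo-* (fromℤ x) (fromℤ y)))

fromℤ-injective : ∀ {x y} → fromℤ x ≡ fromℤ y → x ≡ y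
fromℤ-injective = cong ↥_

fromℤ≡/1 : ∀ x → fromℤ x ≡ x ℚ./ 1
fromℤ≡/1 x = sym (ℚ.↥p/↧p≡p (fromℤ x))

fromℤ-↥ : ∀ p → fromℤ (↥ p) ≡ p ℚ.* fromℤ (↧ p)
fromℤ-↥ p@(mkℚ n d _) = ℚ.toℚᵘ-injective (ℚᵘ.≃-trans step (ℚᵘ.≃-sym (ℚ.toℚᵘ-homo-* p (fromℤ (↧ p)))))
  where
  step : mkℚᵘ n 0 ℚᵘ.≃ mkℚᵘ n d ℚᵘ.* mkℚᵘ (+ suc d) 0
  step = *≡* (trans (cong (λ k → n ℤ.* + k) (ℕ.*-identityʳ (suc d))) (sym (ℤ.*-identityʳ (n ℤ.* + suc d))))

fromℕ : ℕ → ℚ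
fromℕ n = fromℤ (+ n)

fromℕ-+ : ∀ m n → fromℕ (m ℕ.+ n) ≡ fromℕ m ℚ.+ fromℕ n
fromℕ-+ m n = trans (cong fromℤ (ℤ.pos-+ m n)) (fromℤ-+ (+ m) (+ n))

fromℕ-* : ∀ m n → fromℕ (m ℕ.* n) ≡ fromℕ m ℚ.* fromℕ n
fromℕ-* m n = trans (cong fromℤ (ℤ.pos-* m n)) (fromℤ-* (+ m) (+ n))

∑ : {A : Set} → List A → (A → ℚ) → ℚ
∑ [] f = 0ℚ
∑ (x ∷ xs) f = f x ℚ.+ ∑ xs f

syntax ∑ xs (λ x → e) = ∑[ x ∈ xs ] e

module _ {A : Set} where

  ∑-cong : ∀ (xs : List A) {f g : A → ℚ} → (∀ x → f x ≡ g x) → ∑ xs f ≡ ∑ xs g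
  ∑-cong [] f≗g = refl
  ∑-cong (x ∷ xs) f≗g = cong₂ ℚ._+_ (f≗g x) (∑-cong xs f≗g)

  ∑-++ : ∀ (xs ys : List A) f → ∑ (xs ++ ys) f ≡ ∑ xs f ℚ.+ ∑ ys f
  ∑-++ [] ys f = sym (ℚ.+-identityˡ (∑ ys f))
  ∑-++ (x ∷ xs) ys f = trans (cong (f x ℚ.+_) (∑-++ xs ys f)) (sym (ℚ.+-assoc (f x) (∑ xs f) (∑ ys f)))

  ∑-+ : ∀ (xs : List A) f g → ∑[ x ∈ xs ] (f x ℚ.+ g x) ≡ ∑ xs f ℚ.+ ∑ xs g
  ∑-+ [] f g = refl
  ∑-+ (x ∷ xs) f g = trans (cong (f x ℚ.+ g x ℚ.+_) (∑-+ xs f g))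
    (solve 4 (λ a b c d → (a :+ b) :+ (c :+ d) := (a :+ c) :+ (b :+ d)) refl (f x) (g x) (∑ xs f) (∑ xs g))
    where open ℚ-Solver.+-*-Solver

  ∑-*ˡ : ∀ (xs : List A) c f → ∑[ x ∈ xs ] (c ℚ.* f x) ≡ c ℚ.* ∑ xs f
  ∑-*ˡ [] c f = sym (ℚ.*-zeroʳ c)
  ∑-*ˡ (x ∷ xs) c f = trans (cong (c ℚ.* f x ℚ.+_) (∑-*ˡ xs c f)) (sym (ℚ.*-distribˡ-+ c (f x) (∑ xs f)))

  ∑-map : ∀ {B : Set} (xs : List B) (h : B → A) f → ∑ (map h xs) f ≡ ∑ xs (f ∘ h)
  ∑-map [] h f = refl
  ∑-map (x ∷ xs) h f = cong (f (h x) ℚ.+_) (∑-map xs h f)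

_⁺ : ℚ → ℚ
x ⁺ = x ⊔ 0ℚ

⁺-nonNeg : ∀ {x} → 0ℚ ℚ.≤ x → x ⁺ ≡ x
⁺-nonNeg = ℚ.p≥q⇒p⊔q≡p

⁺-neg : ∀ {x} → ¬ 0ℚ ℚ.≤ x → x ⁺ ≡ 0ℚ
⁺-neg x≱0 = ℚ.p≤q⇒p⊔q≡q (ℚ.<⇒≤ (ℚ.≰⇒> x≱0))

*-⁺-nonNeg : ∀ k .{{_ : ℚ.NonNegative k}} x → (k ℚ.* x) ⁺ ≡ k ℚ.* x ⁺
*-⁺-nonNeg k x = begin
  k ℚ.* x ⊔ 0ℚ         ≡⟨ cong (k ℚ.* x ⊔_) (ℚ.*-zeroʳ k) ⟨
  k ℚ.* x ⊔ k ℚ.* 0ℚ   ≡⟨ ℚ.*-distribˡ-⊔-nonNeg k x 0ℚ ⟨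
  k ℚ.* (x ⊔ 0ℚ)       ∎

rank : Summand → ℕ
rank (a , m) = m ℕ.* rkO a

fromℤ-degO : ∀ a m → fromℤ (+ m ℤ.* degO a) ≡ fromℕ (rank (a , m)) ℚ.* a
fromℤ-degO a m = begin
  fromℤ (+ m ℤ.* ↥ a)                     ≡⟨ fromℤ-* (+ m) (↥ a) ⟩
  fromℕ m ℚ.* fromℤ (↥ a)                 ≡⟨ cong (fromℕ m ℚ.*_) (fromℤ-↥ a) ⟩
  fromℕ m ℚ.* (a ℚ.* fromℕ (rkO a))       ≡⟨ solve 3 (λ m a r → m :* (a :* r) := (m :* r) :* a) refl (fromℕ m) a (fromℕ (rkO a)) ⟩
  fromℕ m ℚ.* fromℕ (rkO a) ℚ.* a         ≡⟨ cong (ℚ._* a) (fromℕ-* m (rkO a)) ⟨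
  fromℕ (m ℕ.* rkO a) ℚ.* a               ∎
  where open ℚ-Solver.+-*-Solver

↧ₙ-+-∣ : ∀ p q → ↧ₙ (p ℚ.+ q) ∣ ↧ₙ p ℕ.* ↧ₙ q
↧ₙ-+-∣ p q = divides ℤ.∣ g ∣ (begin
  ↧ₙ p ℕ.* ↧ₙ q             ≡⟨ ℤ.abs-* (↧ p) (↧ q) ⟨
  ℤ.∣ ↧ p ℤ.* ↧ q ∣          ≡⟨ cong ℤ.∣_∣ (ℚ.↧-+ p q) ⟨
  ℤ.∣ ↧ (p ℚ.+ q) ℤ.* g ∣    ≡⟨ ℤ.abs-* (↧ (p ℚ.+ q)) g ⟩
  ↧ₙ (p ℚ.+ q) ℕ.* ℤ.∣ g ∣   ≡⟨ ℕ.*-comm (↧ₙ (p ℚ.+ q)) ℤ.∣ g ∣ ⟩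
  ℤ.∣ g ∣ ℕ.* ↧ₙ (p ℚ.+ q)   ∎)
  where -- the common factor cancelled when normalising p + q (cf. ℚ.↧-+)
        g = gcd (↥ p ℤ.* ↧ q ℤ.+ ↥ q ℤ.* ↧ p) (↧ p ℤ.* ↧ q)

rank-tensorSummand : ∀ s t → rank (tensorSummand s t) ≡ rank s ℕ.* rank t
rank-tensorSummand (a , m) (μ , n) = begin
  m ℕ.* n ℕ.* (rkO a ℕ.* rkO μ) / rkO (a ℚ.+ μ) ℕ.* rkO (a ℚ.+ μ)
    ≡⟨ m/n*n≡m (∣n⇒∣m*n (m ℕ.* n) (↧ₙ-+-∣ a μ)) ⟩
  m ℕ.* n ℕ.* (rkO a ℕ.* rkO μ)
    ≡⟨ solve 4 (λ m n a b → (m :* n) :* (a :* b) := (m :* a) :* (n :* b)) refl m n (rkO a) (rkO μ) ⟩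
  m ℕ.* rkO a ℕ.* (n ℕ.* rkO μ) ∎
  where open ℕ-Solver.+-*-Solver

rank-dual : ∀ a m → rank (- a , m) ≡ rank (a , m)
rank-dual a m = cong (λ d → m ℕ.* ℤ.∣ d ∣) (ℚ.↧-neg a)

-- ∫₀^{rk 𝒱} g(HN(𝒱)′(x)) dx
hnIntegral : Bundle → (ℚ → ℚ) → ℚ
hnIntegral V g = ∑[ s ∈ V ] (fromℕ (rank s) ℚ.* g (proj₁ s))

hnIntegral-cong : ∀ V {f g : ℚ → ℚ} → (∀ a → f a ≡ g a) → hnIntegral V f ≡ hnIntegral V g
hnIntegral-cong V f≗g = ∑-cong V (λ s → cong (fromℕ (rank s) ℚ.*_) (f≗g (proj₁ s)))

hnIntegral-*ˡ : ∀ V c f → hnIntegral V (λ a → c ℚ.* f a) ≡ c ℚ.* hnIntegral V f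
hnIntegral-*ˡ V c f = trans (∑-cong V swap) (∑-*ˡ V c (λ s → fromℕ (rank s) ℚ.* f (proj₁ s)))
  where
  open ℚ-Solver.+-*-Solver
  swap : ∀ s → fromℕ (rank s) ℚ.* (c ℚ.* f (proj₁ s)) ≡ c ℚ.* (fromℕ (rank s) ℚ.* f (proj₁ s))
  swap s = solve 3 (λ r c x → r :* (c :* x) := c :* (r :* x)) refl (fromℕ (rank s)) c (f (proj₁ s))

hnIntegral-dual : ∀ V f → hnIntegral (dual V) f ≡ hnIntegral V (f ∘ -_)
hnIntegral-dual V f = trans (∑-map V _ _) (∑-cong V λ (a , m) → cong (λ r → fromℕ r ℚ.* f (- a)) (rank-dual a m))

hnIntegral-tensorRow : ∀ s W f →
  hnIntegral (map (tensorSummand s) W) f ≡ fromℕ (rank s) ℚ.* hnIntegral W (λ μ → f (proj₁ s ℚ.+ μ))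
hnIntegral-tensorRow s@(a , m) W f = trans (∑-map W _ _) (trans (∑-cong W term) (∑-*ˡ W (fromℕ (rank s)) _))
  where
  term : ∀ t → fromℕ (rank (tensorSummand s t)) ℚ.* f (proj₁ (tensorSummand s t))
             ≡ fromℕ (rank s) ℚ.* (fromℕ (rank t) ℚ.* f (a ℚ.+ proj₁ t))
  term t@(μ , n) = begin
    fromℕ (rank (tensorSummand s t)) ℚ.* f (a ℚ.+ μ)        ≡⟨ cong (λ r → fromℕ r ℚ.* f (a ℚ.+ μ)) (rank-tensorSummand s t) ⟩
    fromℕ (rank s ℕ.* rank t) ℚ.* f (a ℚ.+ μ)               ≡⟨ cong (ℚ._* f (a ℚ.+ μ)) (fromℕ-* (rank s) (rank t)) ⟩
    fromℕ (rank s) ℚ.* fromℕ (rank t) ℚ.* f (a ℚ.+ μ)       ≡⟨ ℚ.*-assoc (fromℕ (rank s)) (fromℕ (rank t)) (f (a ℚ.+ μ)) ⟩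
    fromℕ (rank s) ℚ.* (fromℕ (rank t) ℚ.* f (a ℚ.+ μ))     ∎

hnIntegral-⊗ : ∀ V W f → hnIntegral (V ⊗ W) f ≡ hnIntegral V (λ a → hnIntegral W (λ μ → f (a ℚ.+ μ)))
hnIntegral-⊗ [] W f = refl
hnIntegral-⊗ (s ∷ V) W f = begin
  hnIntegral (map (tensorSummand s) W ++ (V ⊗ W)) f
    ≡⟨ ∑-++ (map (tensorSummand s) W) (V ⊗ W) _ ⟩
  hnIntegral (map (tensorSummand s) W) f ℚ.+ hnIntegral (V ⊗ W) f
    ≡⟨ cong₂ ℚ._+_ (hnIntegral-tensorRow s W f) (hnIntegral-⊗ V W f) ⟩
  hnIntegral (s ∷ V) (λ a → hnIntegral W (λ μ → f (a ℚ.+ μ))) ∎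

fromℤ-deg-nonneg : ∀ V → fromℤ (deg (nonneg V)) ≡ hnIntegral V _⁺
fromℤ-deg-nonneg [] = refl
fromℤ-deg-nonneg ((a , m) ∷ V) with 0ℚ ℚ.≤? a
... | yes 0≤a = trans (fromℤ-+ (+ m ℤ.* degO a) (deg (nonneg V)))
                      (cong₂ ℚ._+_ (trans (fromℤ-degO a m) (cong (fromℕ (rank (a , m)) ℚ.*_) (sym (⁺-nonNeg 0≤a))))
                                   (fromℤ-deg-nonneg V))
... | no 0≰a = begin
  fromℤ (deg (nonneg V))                                  ≡⟨ fromℤ-deg-nonneg V ⟩
  hnIntegral V _⁺                                         ≡⟨ ℚ.+-identityˡ (hnIntegral V _⁺) ⟨
  0ℚ ℚ.+ hnIntegral V _⁺                                  ≡⟨ cong (ℚ._+ hnIntegral V _⁺) (ℚ.*-zeroʳ (fromℕ (rank (a , m)))) ⟨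
  fromℕ (rank (a , m)) ℚ.* 0ℚ ℚ.+ hnIntegral V _⁺          ≡⟨ cong (λ x → fromℕ (rank (a , m)) ℚ.* x ℚ.+ hnIntegral V _⁺) (⁺-neg 0≰a) ⟨
  fromℕ (rank (a , m)) ℚ.* a ⁺ ℚ.+ hnIntegral V _⁺        ∎

slopeGapIntegral : Bundle → Bundle → ℚ
slopeGapIntegral V W = hnIntegral V (λ a → hnIntegral W (λ μ → (- a ℚ.+ μ) ⁺))

fromℤ-deg-nonneg-dual-⊗ : ∀ V W → fromℤ (deg (nonneg (dual V ⊗ W))) ≡ slopeGapIntegral V W
fromℤ-deg-nonneg-dual-⊗ V W = begin
  fromℤ (deg (nonneg (dual V ⊗ W)))                            ≡⟨ fromℤ-deg-nonneg (dual V ⊗ W) ⟩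
  hnIntegral (dual V ⊗ W) _⁺                                   ≡⟨ hnIntegral-⊗ (dual V) W _⁺ ⟩
  hnIntegral (dual V) (λ a → hnIntegral W (λ μ → (a ℚ.+ μ) ⁺))  ≡⟨ hnIntegral-dual V (λ a → hnIntegral W (λ μ → (a ℚ.+ μ) ⁺)) ⟩
  slopeGapIntegral V W                                         ∎

slopes : Bundle → List ℚ
slopes = map proj₁

atSlope : ℚ → ℕ → ℚ → ℕ
atSlope a n b with a ℚ.≟ b
... | yes _ = n
... | no _ = 0

hnLength-∷ : ∀ a m V b → hnLength ((a , m) ∷ V) b ≡ atSlope a (rank (a , m)) b ℕ.+ hnLength V b
hnLength-∷ a m V b with a ℚ.≟ b
... | yes _ = refl
... | no _ = refl

∑-atSlope-∉ : ∀ {a L} n (g : ℚ → ℚ) → a ∉ L → ∑[ b ∈ L ] (fromℕ (atSlope a n b) ℚ.* g b) ≡ 0ℚ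
∑-atSlope-∉ {L = []} n g a∉L = refl
∑-atSlope-∉ {a} {b ∷ L} n g a∉L with a ℚ.≟ b
... | yes a≡b = contradiction (here a≡b) a∉L
... | no _ = trans (cong₂ ℚ._+_ (ℚ.*-zeroˡ (g b)) (∑-atSlope-∉ n g (a∉L ∘ there))) (ℚ.+-identityˡ 0ℚ)

∑-atSlope : ∀ {a L} n (g : ℚ → ℚ) → Unique L → a ∈ L → ∑[ b ∈ L ] (fromℕ (atSlope a n b) ℚ.* g b) ≡ fromℕ n ℚ.* g a
∑-atSlope {a} {b ∷ L} n g (b∉L ∷ L!) a∈ with a ℚ.≟ b | a∈
... | yes refl | _ = trans (cong (fromℕ n ℚ.* g a ℚ.+_) (∑-atSlope-∉ n g (λ a∈L → All.lookup b∉L a∈L refl)))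
                           (ℚ.+-identityʳ (fromℕ n ℚ.* g a))
... | no a≢b | here a≡b = contradiction a≡b a≢b
... | no _ | there a∈L = trans (cong₂ ℚ._+_ (ℚ.*-zeroˡ (g b)) (∑-atSlope n g L! a∈L)) (ℚ.+-identityˡ _)

hnIntegral-hnLength : ∀ V g {L} → Unique L → slopes V ⊆ L →
                      hnIntegral V g ≡ ∑[ b ∈ L ] (fromℕ (hnLength V b) ℚ.* g b)
hnIntegral-hnLength [] g {L} L! V⊆L = sym (trans (∑-cong L (λ b → ℚ.*-zeroˡ (g b))) (zeros L))
  where
  zeros : ∀ L → ∑[ b ∈ L ] 0ℚ ≡ 0ℚ
  zeros [] = refl
  zeros (_ ∷ L) = trans (ℚ.+-identityˡ _) (zeros L)
hnIntegral-hnLength ((a , m) ∷ V) g {L} L! V⊆L = begin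
  fromℕ r ℚ.* g a ℚ.+ hnIntegral V g
    ≡⟨ cong₂ ℚ._+_ (sym (∑-atSlope r g L! (V⊆L (here refl)))) (hnIntegral-hnLength V g L! (V⊆L ∘ there)) ⟩
  ∑[ b ∈ L ] (fromℕ (atSlope a r b) ℚ.* g b) ℚ.+ ∑[ b ∈ L ] (fromℕ (hnLength V b) ℚ.* g b)
    ≡⟨ ∑-+ L _ _ ⟨
  ∑[ b ∈ L ] (fromℕ (atSlope a r b) ℚ.* g b ℚ.+ fromℕ (hnLength V b) ℚ.* g b)
    ≡⟨ ∑-cong L merge ⟩
  ∑[ b ∈ L ] (fromℕ (hnLength ((a , m) ∷ V) b) ℚ.* g b) ∎
  where
  r = rank (a , m)
  merge : ∀ b → fromℕ (atSlope a r b) ℚ.* g b ℚ.+ fromℕ (hnLength V b) ℚ.* g b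
              ≡ fromℕ (hnLength ((a , m) ∷ V) b) ℚ.* g b
  merge b = begin
    fromℕ (atSlope a r b) ℚ.* g b ℚ.+ fromℕ (hnLength V b) ℚ.* g b  ≡⟨ ℚ.*-distribʳ-+ (g b) (fromℕ (atSlope a r b)) (fromℕ (hnLength V b)) ⟨
    (fromℕ (atSlope a r b) ℚ.+ fromℕ (hnLength V b)) ℚ.* g b        ≡⟨ cong (ℚ._* g b) (fromℕ-+ (atSlope a r b) (hnLength V b)) ⟨
    fromℕ (atSlope a r b ℕ.+ hnLength V b) ℚ.* g b                  ≡⟨ cong (λ n → fromℕ n ℚ.* g b) (hnLength-∷ a m V b) ⟨
    fromℕ (hnLength ((a , m) ∷ V) b) ℚ.* g b                        ∎

module _ (k : ℚ) .{{_ : ℚ.NonZero k}} where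

  p*[1/p*q]≡q : ∀ q → k ℚ.* (1/ k ℚ.* q) ≡ q
  p*[1/p*q]≡q q = begin
    k ℚ.* (1/ k ℚ.* q)   ≡⟨ ℚ.*-assoc k (1/ k) q ⟨
    k ℚ.* 1/ k ℚ.* q     ≡⟨ cong (ℚ._* q) (ℚ.*-inverseʳ k) ⟩
    1ℚ ℚ.* q             ≡⟨ ℚ.*-identityˡ q ⟩
    q                    ∎

  1/p*[p*q]≡q : ∀ q → 1/ k ℚ.* (k ℚ.* q) ≡ q
  1/p*[p*q]≡q q = begin
    1/ k ℚ.* (k ℚ.* q)   ≡⟨ ℚ.*-assoc (1/ k) k q ⟨
    1/ k ℚ.* k ℚ.* q     ≡⟨ cong (ℚ._* q) (ℚ.*-inverseˡ k) ⟩
    1ℚ ℚ.* q             ≡⟨ ℚ.*-identityˡ q ⟩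
    q                    ∎

  *-cancelˡ : ∀ {p q} → k ℚ.* p ≡ k ℚ.* q → p ≡ q
  *-cancelˡ {p} {q} kp≡kq = trans (sym (1/p*[p*q]≡q p)) (trans (cong (1/ k ℚ.*_) kp≡kq) (1/p*[p*q]≡q q))

  -- Both integrals become sums over one duplicate-free list covering the slopes of 𝒱′ and k·slopes(𝒱).
  hnIntegral-stretch : ∀ V V' → (∀ a → hnLength V' (k ℚ.* a) ≡ hnLength V a) →
                       ∀ g → hnIntegral V' g ≡ hnIntegral V (g ∘ (k ℚ.*_))
  hnIntegral-stretch V V' stretch g = begin
    hnIntegral V' g                                                ≡⟨ hnIntegral-hnLength V' g L! V'⊆L ⟩
    ∑[ b ∈ map (k ℚ.*_) T ] (fromℕ (hnLength V' b) ℚ.* g b)         ≡⟨ ∑-map T (k ℚ.*_) _ ⟩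
    ∑[ t ∈ T ] (fromℕ (hnLength V' (k ℚ.* t)) ℚ.* g (k ℚ.* t))      ≡⟨ ∑-cong T (λ t → cong (λ n → fromℕ n ℚ.* g (k ℚ.* t)) (stretch t)) ⟩
    ∑[ t ∈ T ] (fromℕ (hnLength V t) ℚ.* g (k ℚ.* t))               ≡⟨ hnIntegral-hnLength V (g ∘ (k ℚ.*_)) T! V⊆T ⟨
    hnIntegral V (g ∘ (k ℚ.*_))                                    ∎
    where
    T = deduplicate ℚ._≟_ (map (1/ k ℚ.*_) (slopes V') ++ slopes V)
    T! : Unique T
    T! = DecUnique.deduplicate-! ℚ._≟_ _
    L! : Unique (map (k ℚ.*_) T)
    L! = Unique.map⁺ *-cancelˡ T!
    V⊆T : slopes V ⊆ T
    V⊆T a∈V = ∈-deduplicate⁺ ℚ._≟_ (∈-++⁺ʳ _ a∈V)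
    V'⊆L : slopes V' ⊆ map (k ℚ.*_) T
    V'⊆L {b} b∈V' = subst (_∈ map (k ℚ.*_) T) (p*[1/p*q]≡q b)
                      (∈-map⁺ (k ℚ.*_) (∈-deduplicate⁺ ℚ._≟_ (∈-++⁺ˡ (∈-map⁺ (1/ k ℚ.*_) b∈V'))))

slopeGapIntegral-stretch : ∀ k .{{_ : Positive k}} V W V' W' →
  (∀ a → hnLength V' (k ℚ.* a) ≡ hnLength V a) → (∀ a → hnLength W' (k ℚ.* a) ≡ hnLength W a) →
  slopeGapIntegral V' W' ≡ k ℚ.* slopeGapIntegral V W
slopeGapIntegral-stretch k V W V' W' stretchV stretchW = begin
  hnIntegral V' (λ a → hnIntegral W' (λ μ → (- a ℚ.+ μ) ⁺))
    ≡⟨ hnIntegral-stretch k {{k≢0}} V V' stretchV (λ a → hnIntegral W' (λ μ → (- a ℚ.+ μ) ⁺)) ⟩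
  hnIntegral V (λ a → hnIntegral W' (λ μ → (- (k ℚ.* a) ℚ.+ μ) ⁺))
    ≡⟨ hnIntegral-cong V (λ a → hnIntegral-stretch k {{k≢0}} W W' stretchW (λ μ → (- (k ℚ.* a) ℚ.+ μ) ⁺)) ⟩
  hnIntegral V (λ a → hnIntegral W (λ μ → (- (k ℚ.* a) ℚ.+ k ℚ.* μ) ⁺))
    ≡⟨ hnIntegral-cong V (λ a → hnIntegral-cong W (gap-scale a)) ⟩
  hnIntegral V (λ a → hnIntegral W (λ μ → k ℚ.* (- a ℚ.+ μ) ⁺))
    ≡⟨ hnIntegral-cong V (λ a → hnIntegral-*ˡ W k (λ μ → (- a ℚ.+ μ) ⁺)) ⟩
  hnIntegral V (λ a → k ℚ.* hnIntegral W (λ μ → (- a ℚ.+ μ) ⁺))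
    ≡⟨ hnIntegral-*ˡ V k (λ a → hnIntegral W (λ μ → (- a ℚ.+ μ) ⁺)) ⟩
  k ℚ.* slopeGapIntegral V W ∎
  where
  open ℚ-Solver.+-*-Solver
  k≢0 = ℚ.pos⇒nonZero k
  gap-scale : ∀ a μ → (- (k ℚ.* a) ℚ.+ k ℚ.* μ) ⁺ ≡ k ℚ.* (- a ℚ.+ μ) ⁺
  gap-scale a μ = trans (cong _⁺ (solve 3 (λ k a μ → :- (k :* a) :+ k :* μ := k :* (:- a :+ μ)) refl k a μ))
                        (*-⁺-nonNeg k {{ℚ.pos⇒nonNeg k}} (- a ℚ.+ μ))

lemma3p17 : (V W V' W' : Bundle) (C : ℕ) → .{{_ : NonZero C}} →
    IsVertStretch C V V' → IsVertStretch C W W' →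
    deg (nonneg (dual V' ⊗ W')) ≡ (+ C) * deg (nonneg (dual V ⊗ W))
lemma3p17 V W V' W' C stretchV stretchW = fromℤ-injective (begin
  fromℤ (deg (nonneg (dual V' ⊗ W')))          ≡⟨ fromℤ-deg-nonneg-dual-⊗ V' W' ⟩
  slopeGapIntegral V' W'                       ≡⟨ slopeGapIntegral-stretch k {{ℚ.normalize-pos C 1}} V W V' W' stretchV stretchW ⟩
  k ℚ.* slopeGapIntegral V W                   ≡⟨ cong₂ ℚ._*_ (fromℤ≡/1 (+ C)) (fromℤ-deg-nonneg-dual-⊗ V W) ⟨
  fromℤ (+ C) ℚ.* fromℤ (deg (nonneg (dual V ⊗ W)))  ≡⟨ fromℤ-* (+ C) (deg (nonneg (dual V ⊗ W))) ⟨
  fromℤ (+ C * deg (nonneg (dual V ⊗ W)))      ∎)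
  where k = + C ℚ./ 1
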